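{- For every odd integer $j\ge1$ and every integer $l\ge3$, the tree $RT(0^j,1^l)$ is not super edge-graceful.
   Context: For a finite simple graph $G$ with $p$ vertices and $q$ edges, $G$ is super edge-graceful if there is a bijection $f$ from $E(G)$ onto $\{0,\pm1,\ldots,\pm\frac{q-1}{2}\}$ when $q$ is odd, and onto $\{\pm1,\ldots,\pm\frac{q}{2}\}$ when $q$ is even, such that the induced vertex labeling $f^+(v)=\sum_{uv\in E(G)} f(uv)$ is a bijection from $V(G)$ onto $\{0,\pm1,\ldots,\pm\frac{p-1}{2}\}$ when $p$ is odd, and onto $\{\pm1,\ldots,\pm\frac{p}{2}\}$ when $p$ is even. $RT(0^j,1^l)$ is the rooted tree whose root $v_0$ has $j+l$ children, $j$ of which are leaves and each of the other $l$ has exactly one child, which is a leaf. -}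

module Defs where

open import Data.Nat as ℕ using (ℕ; zero; suc; _/_; _%_)
open import Data.Integer as ℤ using (ℤ; ∣_∣; 0ℤ)
open import Data.Fin as Fin using (Fin; zero; suc; _↑ˡ_; _↑ʳ_; splitAt)
open import Data.Fin.Properties using () renaming (_≟_ to _≟ᶠ_)
open import Data.Product using (_×_; _,_; proj₁; proj₂; ∃)
open import Data.Sum using ([_,_])
open import Data.Bool using (Bool; if_then_else_; _∨_)
open import Relation.Nullary using (¬_; does)
open import Relation.Binary.PropositionalEquality using (_≡_; _≢_)

record Graph : Set where
  field
    p    : ℕ
    q    : ℕ
    ends : Fin q → Fin p × Fin p
open Graph public

-- Membership in the label set of size n:
--   n odd  : {0, ±1, …, ±(n-1)/2}   (here n / 2 = (n-1)/2)
--   n even : {±1, …, ±n/2}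
InLabels : ℕ → ℤ → Set
InLabels n z = (∣ z ∣ ℕ.≤ n / 2) × (n % 2 ≡ 0 → z ≢ 0ℤ)

record BijOntoLabels {m : ℕ} (n : ℕ) (f : Fin m → ℤ) : Set where
  field
    into       : ∀ x → InLabels n (f x)
    injective  : ∀ x y → f x ≡ f y → x ≡ y
    surjective : ∀ z → InLabels n z → ∃ λ x → f x ≡ z
open BijOntoLabels public

sumℤ : ∀ {n} → (Fin n → ℤ) → ℤ
sumℤ {zero}  g = 0ℤ
sumℤ {suc n} g = g zero ℤ.+ sumℤ (λ i → g (suc i))

incident : ∀ {p} → Fin p → Fin p × Fin p → Bool
incident v (a , b) = does (v ≟ᶠ a) ∨ does (v ≟ᶠ b)

inducedLabel : (G : Graph) → (Fin (q G) → ℤ) → Fin (p G) → ℤ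
inducedLabel G f v = sumℤ (λ e → if incident v (ends G e) then f e else 0ℤ)

SuperEdgeGraceful : Graph → Set
SuperEdgeGraceful G =
  ∃ λ (f : Fin (q G) → ℤ) →
    BijOntoLabels (q G) f × BijOntoLabels (p G) (inducedLabel G f)

-- Vertices: Fin (1 + (j + (l + l))):
--   zero                          = root v₀
--   suc (a ↑ˡ (l + l)),  a : Fin j = the j leaf children of the root
--   suc (j ↑ʳ (b ↑ˡ l)), b : Fin l = the l non-leaf children
--   suc (j ↑ʳ (l ↑ʳ b)), b : Fin l = the leaf child of the b-th non-leaf child
-- Edges: Fin (j + (l + l)), in the same order (leaf edges, spokes, pendant edges).
RT : ℕ → ℕ → Graph
RT j l = record
  { p    = suc (j ℕ.+ (l ℕ.+ l))
  ; q    = j ℕ.+ (l ℕ.+ l)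
  ; ends = λ e → [ (λ a → (zero , suc (a ↑ˡ (l ℕ.+ l))))
                 , (λ e' → [ (λ b → (zero , mid b))
                           , (λ b → (mid b , suc (j ↑ʳ (l ↑ʳ b))))
                           ] (splitAt l e'))
                 ] (splitAt j e)
  }
  where
  mid : Fin l → Fin (suc (j ℕ.+ (l ℕ.+ l)))
  mid b = suc (j ↑ʳ (b ↑ˡ l))

module Submission where

-- RT(0^j,1^l) with j odd is not super edge-graceful.
--
-- The tree has q = j + 2l edges and p = q + 1 vertices, so for odd j
-- the edge-label set {0, ±1, …} has odd size and contains 0, while the
-- vertex-label set {±1, …} has even size and omits 0.  Hence some edge e
-- carries label 0 and no vertex has induced label 0.  Now look at e:
--   * if e ends in a leaf (a leaf edge at the root, or a pendant edge), that
--     leaf has e as its only edge, so its induced label is f(e) = 0;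
--   * if e is a spoke root–w, then w has exactly the spoke and its pendant
--     edge e', so f⁺(w) = 0 + f(e') = f⁺(leaf below w), against injectivity.

open import Defs
open import Data.Nat using (ℕ; _≤_; _%_; z≤n)
open import Relation.Nullary using (¬_)
open import Relation.Binary.PropositionalEquality using (_≡_)

import Data.Nat as ℕ
open import Data.Nat.DivMod using (%-distribˡ-+; %-remove-+ʳ)
open import Data.Nat.Divisibility using (divides)
import Data.Nat.Properties as ℕₚ
open import Data.Integer using (ℤ; 0ℤ; _+_)
open import Data.Integer.Properties using (+-identityˡ; +-identityʳ; +-comm)
open import Data.Fin using (Fin; zero; suc; _↑ˡ_; _↑ʳ_; splitAt)
open import Data.Fin.Properties
  using (suc-injective; splitAt-↑ˡ; splitAt-↑ʳ; splitAt⁻¹-↑ˡ; splitAt⁻¹-↑ʳ)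
  renaming (_≟_ to _≟ᶠ_)
open import Data.Product using (_,_; proj₂; ∃)
open import Data.Sum as Sum using (_⊎_; inj₁; inj₂)
open import Data.Bool using (true; false; if_then_else_; _∨_)
open import Data.Bool.Properties using (∨-zeroʳ)
open import Data.Empty using (⊥)
open import Function using (_∘_; id)
open import Relation.Nullary using (yes; no; does; contradiction)
open import Relation.Nullary.Decidable using (dec-true)
open import Relation.Binary.PropositionalEquality
  using (_≢_; refl; sym; trans; cong; cong₂; subst; module ≡-Reasoning)

open ≡-Reasoning

sumℤ-zero : ∀ {n} (g : Fin n → ℤ) → (∀ i → g i ≡ 0ℤ) → sumℤ g ≡ 0ℤ
sumℤ-zero {ℕ.zero}  g vanish = refl
sumℤ-zero {ℕ.suc n} g vanish =
  cong₂ _+_ (vanish zero) (sumℤ-zero (g ∘ suc) (vanish ∘ suc))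

sumℤ-single : ∀ {n} (g : Fin n → ℤ) (k : Fin n) →
              (∀ i → i ≢ k → g i ≡ 0ℤ) → sumℤ g ≡ g k
sumℤ-single g zero off = begin
  g zero + sumℤ (g ∘ suc) ≡⟨ cong (g zero +_) (sumℤ-zero (g ∘ suc) (λ i → off (suc i) λ ())) ⟩
  g zero + 0ℤ             ≡⟨ +-identityʳ (g zero) ⟩
  g zero                  ∎
sumℤ-single g (suc k) off = begin
  g zero + sumℤ (g ∘ suc) ≡⟨ cong₂ _+_ (off zero λ ())
                               (sumℤ-single (g ∘ suc) k (λ i i≢k → off (suc i) (i≢k ∘ suc-injective))) ⟩
  0ℤ + g (suc k)          ≡⟨ +-identityˡ (g (suc k)) ⟩
  g (suc k)               ∎

sumℤ-pair : ∀ {n} (g : Fin n → ℤ) (k k' : Fin n) → k ≢ k' →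
            (∀ i → i ≢ k → i ≢ k' → g i ≡ 0ℤ) → sumℤ g ≡ g k + g k'
sumℤ-pair g zero zero k≢k' off = contradiction refl k≢k'
sumℤ-pair g zero (suc k') k≢k' off =
  cong (g zero +_)
       (sumℤ-single (g ∘ suc) k' (λ i i≢k' → off (suc i) (λ ()) (i≢k' ∘ suc-injective)))
sumℤ-pair g (suc k) zero k≢k' off = begin
  g zero + sumℤ (g ∘ suc) ≡⟨ cong (g zero +_)
                               (sumℤ-single (g ∘ suc) k (λ i i≢k → off (suc i) (i≢k ∘ suc-injective) (λ ()))) ⟩
  g zero + g (suc k)      ≡⟨ +-comm (g zero) (g (suc k)) ⟩
  g (suc k) + g zero      ∎
sumℤ-pair g (suc k) (suc k') k≢k' off = begin
  g zero + sumℤ (g ∘ suc)       ≡⟨ cong₂ _+_ (off zero (λ ()) (λ ())) (sumℤ-pair (g ∘ suc) k k' (k≢k' ∘ cong suc)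
                                     (λ i i≢k i≢k' → off (suc i) (i≢k ∘ suc-injective) (i≢k' ∘ suc-injective))) ⟩
  0ℤ + (g (suc k) + g (suc k')) ≡⟨ +-identityˡ _ ⟩
  g (suc k) + g (suc k')        ∎

Incident : (G : Graph) → Fin (p G) → Fin (q G) → Set
Incident G v e = incident v (ends G e) ≡ true

contribution : (G : Graph) → (Fin (q G) → ℤ) → Fin (p G) → Fin (q G) → ℤ
contribution G f v e = if incident v (ends G e) then f e else 0ℤ

incident-ends : ∀ {n} {v x y : Fin n} → incident v (x , y) ≡ true → v ≡ x ⊎ v ≡ y
incident-ends {v = v} {x} {y} v∼xy with v ≟ᶠ x | v ≟ᶠ y
... | yes v≡x | _       = inj₁ v≡x
... | no _    | yes v≡y = inj₂ v≡y
... | no _    | no _    = contradiction v∼xy λ ()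

incident-first : ∀ {n} (x y : Fin n) → incident x (x , y) ≡ true
incident-first x y = cong (λ b → b ∨ does (x ≟ᶠ y)) (dec-true (x ≟ᶠ x) refl)

incident-second : ∀ {n} (x y : Fin n) → incident y (x , y) ≡ true
incident-second x y =
  trans (cong (does (y ≟ᶠ x) ∨_) (dec-true (y ≟ᶠ y) refl)) (∨-zeroʳ (does (y ≟ᶠ x)))

contribution-incident : ∀ G f {v e} → Incident G v e → contribution G f v e ≡ f e
contribution-incident G f v∼e = cong (if_then _ else 0ℤ) v∼e

contribution-remote : ∀ G f {v e} → ¬ Incident G v e → contribution G f v e ≡ 0ℤ
contribution-remote G f {v} {e} v≁e with incident v (ends G e)
... | true  = contradiction refl v≁e
... | false = refl

inducedLabel-degree-one : ∀ G f {v e} → Incident G v e →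
  (∀ e' → Incident G v e' → e' ≡ e) → inducedLabel G f v ≡ f e
inducedLabel-degree-one G f {v} {e} v∼e only = begin
  sumℤ (contribution G f v) ≡⟨ sumℤ-single _ e (λ e' e'≢e →
                                  contribution-remote G f {v} (e'≢e ∘ only e')) ⟩
  contribution G f v e      ≡⟨ contribution-incident G f {v} v∼e ⟩
  f e                       ∎

inducedLabel-degree-two : ∀ G f {v e e'} → e ≢ e' → Incident G v e → Incident G v e' →
  (∀ e'' → Incident G v e'' → e'' ≡ e ⊎ e'' ≡ e') → inducedLabel G f v ≡ f e + f e'
inducedLabel-degree-two G f {v} {e} {e'} e≢e' v∼e v∼e' only = begin
  sumℤ (contribution G f v)                    ≡⟨ sumℤ-pair _ e e' e≢e' off ⟩
  contribution G f v e + contribution G f v e' ≡⟨ cong₂ _+_ (contribution-incident G f {v} v∼e)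
                                                            (contribution-incident G f {v} v∼e') ⟩
  f e + f e'                                   ∎
  where
  off : ∀ e'' → e'' ≢ e → e'' ≢ e' → contribution G f v e'' ≡ 0ℤ
  off e'' e''≢e e''≢e' = contribution-remote G f {v} λ v∼e'' →
    Sum.[ e''≢e , e''≢e' ] (only e'' v∼e'')

zero∈odd-labels : ∀ {n} → n % 2 ≡ 1 → InLabels n 0ℤ
zero∈odd-labels odd = z≤n , λ even _ → contradiction (trans (sym odd) even) λ ()

odd-labelling-hits-zero : ∀ {m n} {f : Fin m → ℤ} → BijOntoLabels n f →
                          n % 2 ≡ 1 → ∃ λ x → f x ≡ 0ℤ
odd-labelling-hits-zero {n = n} bij odd = surjective bij 0ℤ (zero∈odd-labels {n} odd)

even-labelling-avoids-zero : ∀ {m n} {f : Fin m → ℤ} → BijOntoLabels n f →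
                             n % 2 ≡ 0 → ∀ x → f x ≢ 0ℤ
even-labelling-avoids-zero bij even x = proj₂ (into bij x) even

+-double-%2 : ∀ m n → (m ℕ.+ (n ℕ.+ n)) % 2 ≡ m % 2
+-double-%2 m n = %-remove-+ʳ m (divides n n+n≡n*2)
  where
  n+n≡n*2 : n ℕ.+ n ≡ n ℕ.* 2
  n+n≡n*2 = trans (cong (n ℕ.+_) (sym (ℕₚ.+-identityʳ n))) (ℕₚ.*-comm 2 n)

suc-odd-even : ∀ m → m % 2 ≡ 1 → ℕ.suc m % 2 ≡ 0
suc-odd-even m odd = trans (%-distribˡ-+ 1 m 2) (cong (λ r → (1 ℕ.+ r) % 2) odd)

-- Every non-root vertex is the lower end of
-- exactly one edge, and its index is one more than that edge's index; this
-- gives a datatype of vertices in which the incidence relation of the tree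
-- is decided by pattern matching.
module Anatomy (j l : ℕ) where

  T : Graph
  T = RT j l

  data Edge : Set where
    leafE  : Fin j → Edge   -- root – a-th leaf child
    spokeE : Fin l → Edge   -- root – b-th non-leaf child w_b
    pendE  : Fin l → Edge   -- w_b – its leaf

  edgeIndex : Edge → Fin (q T)
  edgeIndex (leafE a)  = a ↑ˡ (l ℕ.+ l)
  edgeIndex (spokeE b) = j ↑ʳ (b ↑ˡ l)
  edgeIndex (pendE b)  = j ↑ʳ (l ↑ʳ b)

  edgeOf : Fin (q T) → Edge
  edgeOf e with splitAt j e
  ... | inj₁ a = leafE a
  ... | inj₂ e' with splitAt l e'
  ...   | inj₁ b = spokeE b
  ...   | inj₂ b = pendE b

  edgeOf-edgeIndex : ∀ ε → edgeOf (edgeIndex ε) ≡ ε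
  edgeOf-edgeIndex (leafE a)  rewrite splitAt-↑ˡ j a (l ℕ.+ l) = refl
  edgeOf-edgeIndex (spokeE b) rewrite splitAt-↑ʳ j (l ℕ.+ l) (b ↑ˡ l) | splitAt-↑ˡ l b l = refl
  edgeOf-edgeIndex (pendE b)  rewrite splitAt-↑ʳ j (l ℕ.+ l) (l ↑ʳ b) | splitAt-↑ʳ l l b = refl

  edgeIndex-edgeOf : ∀ e → edgeIndex (edgeOf e) ≡ e
  edgeIndex-edgeOf e with splitAt j e in split₁
  ... | inj₁ a = splitAt⁻¹-↑ˡ split₁
  ... | inj₂ e' with splitAt l e' in split₂
  ...   | inj₁ b = trans (cong (j ↑ʳ_) (splitAt⁻¹-↑ˡ split₂)) (splitAt⁻¹-↑ʳ split₁)
  ...   | inj₂ b = trans (cong (j ↑ʳ_) (splitAt⁻¹-↑ʳ split₂)) (splitAt⁻¹-↑ʳ split₁)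

  edgeIndex-injective : ∀ {ε ε'} → edgeIndex ε ≡ edgeIndex ε' → ε ≡ ε'
  edgeIndex-injective {ε} {ε'} eq =
    trans (sym (edgeOf-edgeIndex ε)) (trans (cong edgeOf eq) (edgeOf-edgeIndex ε'))

  data Vertex : Set where
    root  : Vertex
    lower : Edge → Vertex

  ⟦_⟧ : Vertex → Fin (p T)
  ⟦ root ⟧    = zero
  ⟦ lower ε ⟧ = suc (edgeIndex ε)

  ⟦⟧-injective : ∀ {v w} → ⟦ v ⟧ ≡ ⟦ w ⟧ → v ≡ w
  ⟦⟧-injective {root}    {root}     _  = refl
  ⟦⟧-injective {root}    {lower _}  ()
  ⟦⟧-injective {lower _} {root}     ()
  ⟦⟧-injective {lower ε} {lower ε'} eq = cong lower (edgeIndex-injective (suc-injective eq))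

  upper : Edge → Vertex
  upper (leafE a)  = root
  upper (spokeE b) = root
  upper (pendE b)  = lower (spokeE b)

  ends-edgeIndex : ∀ ε → ends T (edgeIndex ε) ≡ (⟦ upper ε ⟧ , ⟦ lower ε ⟧)
  ends-edgeIndex (leafE a)  rewrite splitAt-↑ˡ j a (l ℕ.+ l) = refl
  ends-edgeIndex (spokeE b) rewrite splitAt-↑ʳ j (l ℕ.+ l) (b ↑ˡ l) | splitAt-↑ˡ l b l = refl
  ends-edgeIndex (pendE b)  rewrite splitAt-↑ʳ j (l ℕ.+ l) (l ↑ʳ b) | splitAt-↑ʳ l l b = refl

  incident-T : ∀ v e → Incident T ⟦ v ⟧ e → v ≡ upper (edgeOf e) ⊎ v ≡ lower (edgeOf e)
  incident-T v e v∼e = Sum.map ⟦⟧-injective ⟦⟧-injective (incident-ends v∼ends)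
    where
    v∼ends : incident ⟦ v ⟧ (⟦ upper (edgeOf e) ⟧ , ⟦ lower (edgeOf e) ⟧) ≡ true
    v∼ends = subst (λ xy → incident ⟦ v ⟧ xy ≡ true)
                   (trans (cong (ends T) (sym (edgeIndex-edgeOf e))) (ends-edgeIndex (edgeOf e)))
                   v∼e

  upper-incident : ∀ ε → Incident T ⟦ upper ε ⟧ (edgeIndex ε)
  upper-incident ε = subst (λ xy → incident ⟦ upper ε ⟧ xy ≡ true) (sym (ends-edgeIndex ε))
                           (incident-first ⟦ upper ε ⟧ ⟦ lower ε ⟧)

  lower-incident : ∀ ε → Incident T ⟦ lower ε ⟧ (edgeIndex ε)
  lower-incident ε = subst (λ xy → incident ⟦ lower ε ⟧ xy ≡ true) (sym (ends-edgeIndex ε))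
                           (incident-second ⟦ upper ε ⟧ ⟦ lower ε ⟧)

  edges-at-lower : ∀ ε e → Incident T ⟦ lower ε ⟧ e →
                   e ≡ edgeIndex ε ⊎ upper (edgeOf e) ≡ lower ε
  edges-at-lower ε e ε∼e with incident-T (lower ε) e ε∼e
  ... | inj₁ below  = inj₂ (sym below)
  ... | inj₂ itself =
    inj₁ (trans (sym (edgeIndex-edgeOf e)) (cong edgeIndex (sym (lower-injective itself))))
    where
    lower-injective : ∀ {ε ε'} → lower ε ≡ lower ε' → ε ≡ ε'
    lower-injective refl = refl

  nothing-below-leaf : ∀ a ε → upper ε ≢ lower (leafE a)
  nothing-below-leaf a (leafE _)  ()
  nothing-below-leaf a (spokeE _) ()
  nothing-below-leaf a (pendE _)  ()

  nothing-below-pend : ∀ b ε → upper ε ≢ lower (pendE b)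
  nothing-below-pend b (leafE _)  ()
  nothing-below-pend b (spokeE _) ()
  nothing-below-pend b (pendE _)  ()

  below-spoke : ∀ b ε → upper ε ≡ lower (spokeE b) → ε ≡ pendE b
  below-spoke b (pendE .b) refl = refl

  label-of-leaf : ∀ f ε → (∀ ε' → upper ε' ≢ lower ε) →
                  inducedLabel T f ⟦ lower ε ⟧ ≡ f (edgeIndex ε)
  label-of-leaf f ε childless = inducedLabel-degree-one T f {⟦ lower ε ⟧} (lower-incident ε) only
    where
    only : ∀ e → Incident T ⟦ lower ε ⟧ e → e ≡ edgeIndex ε
    only e ε∼e = Sum.[ id , (λ below → contradiction below (childless (edgeOf e))) ]
                   (edges-at-lower ε e ε∼e)

  label-of-spoke-end : ∀ f b → inducedLabel T f ⟦ lower (spokeE b) ⟧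
                                 ≡ f (edgeIndex (spokeE b)) + f (edgeIndex (pendE b))
  label-of-spoke-end f b =
    inducedLabel-degree-two T f {⟦ lower (spokeE b) ⟧} (λ eq → spoke≢pend (edgeIndex-injective eq))
      (lower-incident (spokeE b)) (upper-incident (pendE b)) only
    where
    spoke≢pend : spokeE b ≢ pendE b
    spoke≢pend ()
    only : ∀ e → Incident T ⟦ lower (spokeE b) ⟧ e →
           e ≡ edgeIndex (spokeE b) ⊎ e ≡ edgeIndex (pendE b)
    only e w∼e with edges-at-lower (spokeE b) e w∼e
    ... | inj₁ spoke = inj₁ spoke
    ... | inj₂ below =
      inj₂ (trans (sym (edgeIndex-edgeOf e)) (cong edgeIndex (below-spoke b (edgeOf e) below)))

  zero-spoke-repeats-label : ∀ f b → f (edgeIndex (spokeE b)) ≡ 0ℤ →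
    inducedLabel T f ⟦ lower (spokeE b) ⟧ ≡ inducedLabel T f ⟦ lower (pendE b) ⟧
  zero-spoke-repeats-label f b spoke≡0 = begin
    inducedLabel T f ⟦ lower (spokeE b) ⟧              ≡⟨ label-of-spoke-end f b ⟩
    f (edgeIndex (spokeE b)) + f (edgeIndex (pendE b)) ≡⟨ cong (_+ f (edgeIndex (pendE b))) spoke≡0 ⟩
    0ℤ + f (edgeIndex (pendE b))                       ≡⟨ +-identityˡ _ ⟩
    f (edgeIndex (pendE b))                            ≡⟨ sym (label-of-leaf f (pendE b) (nothing-below-pend b)) ⟩
    inducedLabel T f ⟦ lower (pendE b) ⟧               ∎

  spoke-end≢pend-end : ∀ b → ⟦ lower (spokeE b) ⟧ ≢ ⟦ lower (pendE b) ⟧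
  spoke-end≢pend-end b eq with ⟦⟧-injective {lower (spokeE b)} {lower (pendE b)} eq
  ... | ()

RT-size-odd : ∀ j l → j % 2 ≡ 1 → q (RT j l) % 2 ≡ 1
RT-size-odd j l j-odd = trans (+-double-%2 j l) j-odd

RT-order-even : ∀ j l → j % 2 ≡ 1 → p (RT j l) % 2 ≡ 0
RT-order-even j l j-odd = suc-odd-even (q (RT j l)) (RT-size-odd j l j-odd)

lemma14 : (j l : ℕ) → j % 2 ≡ 1 → 3 ≤ l → ¬ SuperEdgeGraceful (RT j l)
lemma14 j l j-odd _ (f , edge-bij , vertex-bij)
  with odd-labelling-hits-zero edge-bij (RT-size-odd j l j-odd)
... | e , fe≡0 = no-zero-edge (edgeOf e) (trans (cong f (edgeIndex-edgeOf e)) fe≡0)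
  where
  open Anatomy j l

  label≢0 : ∀ v → inducedLabel T f v ≢ 0ℤ
  label≢0 = even-labelling-avoids-zero vertex-bij (RT-order-even j l j-odd)

  no-zero-edge : ∀ ε → f (edgeIndex ε) ≡ 0ℤ → ⊥
  no-zero-edge (leafE a)  leaf≡0 =
    label≢0 ⟦ lower (leafE a) ⟧ (trans (label-of-leaf f (leafE a) (nothing-below-leaf a)) leaf≡0)
  no-zero-edge (pendE b)  pend≡0 =
    label≢0 ⟦ lower (pendE b) ⟧ (trans (label-of-leaf f (pendE b) (nothing-below-pend b)) pend≡0)
  no-zero-edge (spokeE b) spoke≡0 =
    spoke-end≢pend-end b (injective vertex-bij _ _ (zero-spoke-repeats-label f b spoke≡0))
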